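{- Let $k,m\ge1$ and $\mathbf r=(r_1,\dots,r_m)$ with all $r_l\ge1$. Let $F_k(\mathbf r)$ (resp. $S_k(\mathbf r)$) be the number of ways for $m$ species with $r_1,\dots,r_m$ representatives to each independently choose a committee placement at a round table with $k$ chairs (resp. such that, in addition, no chair is left empty). Then $$F_k(\mathbf r)=\prod_{l=1}^mF_k(r_l)=\prod_{l=1}^m r_l\binom{k+r_l-1}{r_l} \qquad\text{and}\qquad S_k(\mathbf r)=\sum_{i=1}^k(-1)^{k-i}\binom{k}{i}\prod_{l=1}^m r_l\binom{i+r_l-1}{r_l}.$$
   Context: Committee placement: a round table carries $k$ chairs in a fixed cyclic order. A species has $r$ representatives, linearly ordered by age. A committee placement consists of choosing a nonempty subset $A$ of the representatives with $|A|=a$, a set $C$ of $a$ chairs, and a chair $c\in C$ on which the eldest member of $A$ sits; the other members of $A$ then occupy the remaining chairs of $C$ one after another by age, following the cyclic order starting after $c$. $F_k(r)$ denotes the number of committee placements for one species with $r$ representatives. With several species, each species chooses its placement independently; representatives of different species may share a chair, representatives of the same species never do. A chair is empty if no representative of any species sits on it. -}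

module Defs where

open import Data.Nat using (ℕ; zero; suc; _+_; _*_; _∸_; _≤_)
open import Data.Nat.Combinatorics using (_C_)
open import Data.Integer as ℤ using (ℤ; +_; -_; _^_)
open import Data.Fin using (Fin)
open import Data.Fin.Subset using (Subset; _∈_; ∣_∣; _∪_; ⊥; ⊤)
open import Data.Vec using (Vec; []; _∷_)
open import Data.List using (List; map; upTo; foldr)
open import Data.Product using (Σ; _×_; _,_)
open import Data.Unit using () renaming (⊤ to Unit)
open import Relation.Binary.PropositionalEquality using (_≡_)

-- A committee placement of one species with r representatives (indexed by Fin r,
-- linearly ordered by age) at a round table with k chairs (Fin k, in cyclic order):
-- a nonempty subset A of representatives, a set C of chairs with |C| = |A|,
-- and a chair c ∈ C for the eldest member.  The rest of the seating is then
-- determined, so a placement is exactly such a triple (A , C , c).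
record Placement (k r : ℕ) : Set where
  constructor placement
  field
    A        : Subset r
    C        : Subset k
    c        : Fin k
    nonempty : 1 ≤ ∣ A ∣
    sameSize : ∣ A ∣ ≡ ∣ C ∣
    eldest   : c ∈ C

Placements : (k : ℕ) → {m : ℕ} → Vec ℕ m → Set
Placements k []       = Unit
Placements k (r ∷ rs) = Placement k r × Placements k rs

occupied : {k m : ℕ} (rs : Vec ℕ m) → Placements k rs → Subset k
occupied []       _        = ⊥
occupied (r ∷ rs) (p , ps) = Placement.C p ∪ occupied rs ps

SurjPlacements : (k : ℕ) → {m : ℕ} → Vec ℕ m → Set
SurjPlacements k rs = Σ (Placements k rs) (λ ps → occupied rs ps ≡ ⊤)

prodV : {m : ℕ} → (ℕ → ℕ) → Vec ℕ m → ℕ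
prodV f []       = 1
prodV f (r ∷ rs) = f r * prodV f rs

formula : ℕ → ℕ → ℕ
formula k r = r * ((k + r ∸ 1) C r)

surjFormula : {m : ℕ} → ℕ → Vec ℕ m → ℤ
surjFormula k rs =
  foldr ℤ._+_ (+ 0)
    (map (λ j → let i = suc j in
                ((- (+ 1)) ^ (k ∸ i)) ℤ.* (+ (k C i)) ℤ.* (+ prodV (formula i) rs))
         (upTo k))

module Submission where

-- A placement is determined by the triple (A , S , c) with ∣ A ∣ = ∣ S ∣ ≥ 1 and c ∈ S, so the
-- placements using only chairs from a set of n chairs number ∑_A ∣ A ∣ · C(n, ∣ A ∣) =
-- r · C(n + r - 1, r), and independent species multiply: P(n) = ∏_l F_n(r_l).
-- For surjectivity let h(p, s) count the tuples whose occupied set O satisfies p ⊆ O ⊆ s.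
-- Splitting on whether a chair x ∈ p is occupied gives h(p - x, s) = h(p, s) + h(p - x, s - x),
-- the recursion of the forward difference; with h(∅, s) = P(∣ s ∣) induction yields
-- h(p, s) = Δ^∣p∣ P (∣ s ∣ - ∣ p ∣).  So the surjective count is Δ^k P (0), which expands to the
-- alternating binomial sum; its i = 0 term vanishes because P(0) = 0.

module FiniteDifference where

  open import Data.Integer using (ℤ; +_; -_; _+_; _-_; _*_; _^_; 0ℤ; 1ℤ)
  open import Data.Integer.Properties using (pos-+; -1*i≡-i; *-zeroˡ; *-zeroʳ; +-identityˡ)
  open import Data.Integer.Tactic.RingSolver using (solve-∀)
  open import Data.List using (foldr; map; applyUpTo; upTo)
  open import Data.Nat as ℕ using (ℕ; zero; suc; _∸_; _<_; s≤s)
  open import Data.Nat.Properties as ℕ using (≮⇒≥)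
  open import Data.Nat.Combinatorics using (_C_; nCk+nC[k+1]≡[n+1]C[k+1]; k>n⇒nCk≡0)
  open import Function using (_∘_)
  open import Relation.Nullary.Decidable using (yes; no)
  open import Relation.Binary.PropositionalEquality using (_≡_; refl; sym; trans; cong; cong₂; module ≡-Reasoning)
  open ≡-Reasoning

  Δ : (ℕ → ℤ) → ℕ → ℤ
  Δ g n = g (suc n) - g n

  Δ[_] : ℕ → (ℕ → ℤ) → ℕ → ℤ
  Δ[ zero  ] g = g
  Δ[ suc t ] g = Δ (Δ[ t ] g)

  split⇒Δ : ∀ (g : ℕ → ℤ) u {a b c} → a ℕ.+ c ≡ b → + b ≡ g (suc u) → + c ≡ g u → + a ≡ Δ g u
  split⇒Δ g u {a} {b} {c} a+c≡b b≡ c≡ = begin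
    + a                   ≡⟨ x≡[x+y]-y (+ a) (+ c) ⟩
    (+ a + + c) - + c     ≡⟨ cong (_- + c) (sym (pos-+ a c)) ⟩
    + (a ℕ.+ c) - + c     ≡⟨ cong₂ (λ x y → + x - y) a+c≡b c≡ ⟩
    + b - g u             ≡⟨ cong (_- g u) b≡ ⟩
    g (suc u) - g u       ∎
    where
    x≡[x+y]-y : ∀ x y → x ≡ (x + y) - y
    x≡[x+y]-y = solve-∀

  ∑< : ℕ → (ℕ → ℤ) → ℤ
  ∑< zero    f = 0ℤ
  ∑< (suc n) f = f 0 + ∑< n (f ∘ suc)

  ∑<-cong : ∀ n {f g : ℕ → ℤ} → (∀ i → f i ≡ g i) → ∑< n f ≡ ∑< n g
  ∑<-cong zero    f≗g = refl
  ∑<-cong (suc n) f≗g = cong₂ _+_ (f≗g 0) (∑<-cong n (f≗g ∘ suc))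

  ∑<-zero : ∀ n → ∑< n (λ _ → 0ℤ) ≡ 0ℤ
  ∑<-zero zero    = refl
  ∑<-zero (suc n) = trans (+-identityˡ _) (∑<-zero n)

  ∑<-distrib-minus : ∀ n (f g : ℕ → ℤ) → ∑< n (λ i → f i - g i) ≡ ∑< n f - ∑< n g
  ∑<-distrib-minus zero    f g = refl
  ∑<-distrib-minus (suc n) f g = begin
    (f 0 - g 0) + ∑< n (λ i → f (suc i) - g (suc i))  ≡⟨ cong (λ x → (f 0 - g 0) + x) (∑<-distrib-minus n _ _) ⟩
    (f 0 - g 0) + (∑< n (f ∘ suc) - ∑< n (g ∘ suc))   ≡⟨ interchange (f 0) (g 0) _ _ ⟩
    (f 0 + ∑< n (f ∘ suc)) - (g 0 + ∑< n (g ∘ suc))   ∎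
    where
    interchange : ∀ a b c d → (a - b) + (c - d) ≡ (a + c) - (b + d)
    interchange = solve-∀

  foldr-applyUpTo≡∑< : ∀ n (f : ℕ → ℤ) (h : ℕ → ℕ) → foldr _+_ 0ℤ (map f (applyUpTo h n)) ≡ ∑< n (f ∘ h)
  foldr-applyUpTo≡∑< zero    f h = refl
  foldr-applyUpTo≡∑< (suc n) f h = cong (λ x → f (h 0) + x) (foldr-applyUpTo≡∑< n f (h ∘ suc))

  signed-binomial : ℕ → ℕ → ℤ
  signed-binomial t i = (- + 1) ^ (t ∸ i) * + (t C i)

  private
    sign-step : ∀ {t i} → i < t → (- + 1) ^ (t ∸ i) ≡ - (- + 1) ^ (t ∸ suc i)
    sign-step {suc t} {zero}  _         = -1*i≡-i _
    sign-step {suc t} {suc i} (s≤s i<t) = sign-step i<t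

    -- Either the sign flips (i < t) or the binomial coefficient vanishes (t ≤ i).
    sign-flip : ∀ t i → (- + 1) ^ (t ∸ i) * + (t C suc i) ≡ - signed-binomial t (suc i)
    sign-flip t i with i ℕ.<? t
    ... | yes i<t = trans (cong (_* + (t C suc i)) (sign-step i<t))
                          (neg-distribˡ-* ((- + 1) ^ (t ∸ suc i)) (+ (t C suc i)))
      where
      neg-distribˡ-* : ∀ a b → (- a) * b ≡ - (a * b)
      neg-distribˡ-* = solve-∀
    ... | no  i≮t rewrite k>n⇒nCk≡0 (s≤s (≮⇒≥ i≮t)) =
      trans (*-zeroʳ ((- + 1) ^ (t ∸ i))) (sym (cong -_ (*-zeroʳ ((- + 1) ^ (t ∸ suc i)))))

  signed-pascal : ∀ t i → signed-binomial (suc t) (suc i) ≡ signed-binomial t i - signed-binomial t (suc i)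
  signed-pascal t i = begin
    s * + (suc t C suc i)                    ≡⟨ cong (λ x → s * + x) (sym (nCk+nC[k+1]≡[n+1]C[k+1] t i)) ⟩
    s * + (t C i ℕ.+ t C suc i)              ≡⟨ cong (s *_) (pos-+ (t C i) (t C suc i)) ⟩
    s * (+ (t C i) + + (t C suc i))          ≡⟨ *-distribˡ-+ s _ _ ⟩
    s * + (t C i) + s * + (t C suc i)        ≡⟨ cong (λ x → signed-binomial t i + x) (sign-flip t i) ⟩
    signed-binomial t i - signed-binomial t (suc i) ∎
    where
    s = (- + 1) ^ (t ∸ i)
    *-distribˡ-+ : ∀ a b c → a * (b + c) ≡ a * b + a * c
    *-distribˡ-+ = solve-∀

  -- Any bound n > t works, since the coefficients vanish beyond t; this frees the
  -- induction from having to split off a last term.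
  Δ[]≡∑< : ∀ t n → t < n → ∀ (g : ℕ → ℤ) u → Δ[ t ] g u ≡ ∑< n (λ i → signed-binomial t i * g (u ℕ.+ i))
  Δ[]≡∑< zero (suc n) _ g u = begin
    g u                     ≡⟨ cong g (sym (ℕ.+-identityʳ u)) ⟩
    g (u ℕ.+ 0)             ≡⟨ x≡1*x+0 (g (u ℕ.+ 0)) ⟩
    1ℤ * g (u ℕ.+ 0) + 0ℤ   ≡⟨ cong (λ x → 1ℤ * g (u ℕ.+ 0) + x)
                                    (sym (trans (∑<-cong n (λ i → *-zeroˡ (g (u ℕ.+ suc i)))) (∑<-zero n))) ⟩
    _                       ∎
    where
    x≡1*x+0 : ∀ x → x ≡ 1ℤ * x + 0ℤ
    x≡1*x+0 = solve-∀
  Δ[]≡∑< (suc t) (suc n) (s≤s t<n) g u = begin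
    Δ[ t ] g (suc u) - Δ[ t ] g u
      ≡⟨ cong₂ _-_ (Δ[]≡∑< t n t<n g (suc u)) (Δ[]≡∑< t (suc n) (ℕ.m<n⇒m<1+n t<n) g u) ⟩
    ∑< n (λ i → b t i * g (suc u ℕ.+ i)) - (b t 0 * g₀ + ∑< n (λ i → b t (suc i) * h i))
      ≡⟨ cong (λ x → x - (b t 0 * g₀ + ∑< n (λ i → b t (suc i) * h i)))
              (∑<-cong n (λ i → cong (λ m → b t i * g m) (sym (ℕ.+-suc u i)))) ⟩
    ∑< n (λ i → b t i * h i) - (b t 0 * g₀ + ∑< n (λ i → b t (suc i) * h i))
      ≡⟨ rearrange ((- + 1) ^ t) g₀ (∑< n (λ i → b t i * h i)) (∑< n (λ i → b t (suc i) * h i)) ⟩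
    b (suc t) 0 * g₀ + (∑< n (λ i → b t i * h i) - ∑< n (λ i → b t (suc i) * h i))
      ≡⟨ cong (λ x → b (suc t) 0 * g₀ + x) (sym (∑<-distrib-minus n _ _)) ⟩
    b (suc t) 0 * g₀ + ∑< n (λ i → b t i * h i - b t (suc i) * h i)
      ≡⟨ cong (λ x → b (suc t) 0 * g₀ + x) (∑<-cong n (λ i →
           trans (sym (*-distribʳ-minus (h i) (b t i) (b t (suc i)))) (cong (_* h i) (sym (signed-pascal t i))))) ⟩
    b (suc t) 0 * g₀ + ∑< n (λ i → b (suc t) (suc i) * h i) ∎
    where
    b = signed-binomial
    g₀ = g (u ℕ.+ 0)
    h : ℕ → ℤ
    h i = g (u ℕ.+ suc i)
    -- b (suc t) 0 unfolds to (- 1 * (- 1) ^ t) * 1, i.e. - b t 0.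
    rearrange : ∀ s x y z → y - ((s * + 1) * x + z) ≡ ((- + 1 * s) * + 1) * x + (y - z)
    rearrange = solve-∀
    *-distribʳ-minus : ∀ x a c → (a - c) * x ≡ a * x - c * x
    *-distribʳ-minus = solve-∀

  Δ[]-at-0 : ∀ t (g : ℕ → ℤ) → g 0 ≡ 0ℤ →
             Δ[ t ] g 0 ≡ foldr _+_ 0ℤ (map (λ j → signed-binomial t (suc j) * g (suc j)) (upTo t))
  Δ[]-at-0 t g g0≡0 = begin
    Δ[ t ] g 0                                      ≡⟨ Δ[]≡∑< t (suc t) (ℕ.n<1+n t) g 0 ⟩
    signed-binomial t 0 * g 0 + ∑< t term           ≡⟨ cong (λ x → signed-binomial t 0 * x + ∑< t term) g0≡0 ⟩
    signed-binomial t 0 * 0ℤ + ∑< t term            ≡⟨ cong (_+ ∑< t term) (*-zeroʳ (signed-binomial t 0)) ⟩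
    0ℤ + ∑< t term                                  ≡⟨ +-identityˡ _ ⟩
    ∑< t term                                       ≡⟨ sym (foldr-applyUpTo≡∑< t term (λ j → j)) ⟩
    foldr _+_ 0ℤ (map term (upTo t))                ∎
    where
    term : ℕ → ℤ
    term j = signed-binomial t (suc j) * g (suc j)

open FiniteDifference

open import Algebra.Properties.CommutativeSemigroup using (x∙yz≈y∙xz)
open import Data.Bool using (Bool; true; false; T; not; _∧_; _∨_)
open import Data.Bool.Properties as Bool using (T-irrelevant)
open import Data.Empty renaming (⊥ to Empty)
open import Data.Fin using (Fin; zero; suc)
open import Data.Fin.Permutation using (↔⇒≡)
open import Data.Fin.Properties using (0↔⊥; 1↔⊤; +↔⊎; *↔×)
open import Data.Fin.Subset using (Subset; ∣_∣; _∈_; _∉_; _⊆_; _∪_; _─_; _-_; ⁅_⁆; ⊥; ⊤; Nonempty)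
open import Data.Fin.Subset.Properties
  using (_∈?_; p─⊥≡p; p─q⊆p; x∈p∧x∉q⇒x∈p─q; ⊆-refl; ∣⊤∣≡n)
open import Data.Integer using (+_)
open import Data.Nat using (ℕ; zero; suc; _+_; _*_; _∸_; _≤_; _≤?_; _≟_; _≤ᵇ_; _≡ᵇ_)
open import Data.Nat.Combinatorics using (_C_; nCk+nC[k+1]≡[n+1]C[k+1]; k>n⇒nCk≡0)
open import Data.Nat.Properties
  using (*-commutativeSemigroup; *-comm; *-zeroʳ; +-identityʳ; +-comm; +-suc; suc-injective; n<1+n; ≤-irrelevant; ≡-irrelevant)
open import Data.Nat.Tactic.RingSolver using (solve-∀)
open import Data.Product using (Σ; Σ-syntax; _×_; _,_; proj₁; proj₂)
open import Data.Product.Function.Dependent.Propositional using (congˡ) renaming (cong to Σ-cong)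
open import Data.Product.Function.NonDependent.Propositional using (_×-↔_)
open import Data.Sum using (_⊎_; inj₁; inj₂)
open import Data.Sum.Function.Propositional using (_⊎-↔_)
open import Data.Unit using (tt) renaming (⊤ to Unit)
open import Data.Vec using (Vec; []; _∷_; lookup; here; there)
open import Data.Vec.Properties using (≡-dec)
open import Data.Vec.Properties.WithK using ([]=-irrelevant)
open import Function using (_∘_; _↔_; _⇔_; Inverse; Equivalence; mk↔ₛ′; mk⇔)
open import Function.Properties.Inverse using (↔-refl; ↔-sym; ↔-trans)
open import Function.Related.TypeIsomorphisms using (Σ-assoc; Σ-distribˡ-⊎; Σ-distribʳ-⊎)
open import Relation.Binary.PropositionalEquality
  using (_≡_; refl; sym; trans; subst; cong; cong₂; _≗_; module ≡-Reasoning)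
open import Relation.Nullary.Decidable using (Dec; does; True; True-↔; isYes≗does)
open import Relation.Nullary.Irrelevant using (Irrelevant)
open import Axiom.UniquenessOfIdentityProofs using (module Decidable⇒UIP)

open import Defs

open ≡-Reasoning

record Finite (X : Set) : Set₁ where
  field
    ∑     : (X → ℕ) → ℕ
    Σ↔Fin : {B : X → Set} {f : X → ℕ} → (∀ x → B x ↔ Fin (f x)) → Σ X B ↔ Fin (∑ f)

open Finite public

Fin-cong : ∀ {m n} → m ≡ n → Fin m ↔ Fin n
Fin-cong refl = ↔-refl

-- The laws of ∑ follow from Σ↔Fin alone: count one Σ-type in two ways and compare
-- the cardinalities with ↔⇒≡.
module _ {X : Set} (F : Finite X) where

  private
    counting : (f : X → ℕ) → Σ X (Fin ∘ f) ↔ Fin (∑ F f)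
    counting f = Σ↔Fin F (λ _ → ↔-refl)

  ∑-cong : ∀ {f g : X → ℕ} → f ≗ g → ∑ F f ≡ ∑ F g
  ∑-cong {f} f≗g = ↔⇒≡ (↔-trans (↔-sym (counting f)) (Σ↔Fin F (Fin-cong ∘ f≗g)))

  ∑-distrib-+ : ∀ (f g : X → ℕ) → ∑ F (λ x → f x + g x) ≡ ∑ F f + ∑ F g
  ∑-distrib-+ f g = ↔⇒≡ (↔-trans (↔-sym (Σ↔Fin F (λ _ → ↔-sym +↔⊎)))
                     (↔-trans Σ-distribˡ-⊎ (↔-trans (counting f ⊎-↔ counting g) (↔-sym +↔⊎))))

  ∑-distribʳ-* : ∀ (f : X → ℕ) c → ∑ F (λ x → f x * c) ≡ ∑ F f * c
  ∑-distribʳ-* f c = ↔⇒≡ (↔-trans (↔-sym (Σ↔Fin F (λ _ → ↔-sym *↔×)))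
                      (↔-trans (↔-sym Σ-assoc) (↔-trans (counting f ×-↔ ↔-refl) (↔-sym *↔×))))

  ∑-distribˡ-* : ∀ c (f : X → ℕ) → ∑ F (λ x → c * f x) ≡ c * ∑ F f
  ∑-distribˡ-* c f = trans (∑-cong (λ x → *-comm c (f x))) (trans (∑-distribʳ-* f c) (*-comm (∑ F f) c))

  ∑-zero : ∑ F (λ _ → 0) ≡ 0
  ∑-zero = trans (∑-distribʳ-* (λ _ → 0) 0) (*-zeroʳ (∑ F (λ _ → 0)))

  ↔Fin-∑1 : X ↔ Fin (∑ F (λ _ → 1))
  ↔Fin-∑1 = ↔-trans (mk↔ₛ′ (_, tt) proj₁ (λ _ → refl) (λ _ → refl)) (Σ↔Fin F (λ _ → ↔-sym 1↔⊤))

Empty-finite : Finite Empty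
Empty-finite .∑ _       = 0
Empty-finite .Σ↔Fin _   = mk↔ₛ′ (λ ()) (λ ()) (λ ()) (λ ())

Unit-finite : Finite Unit
Unit-finite .∑ f        = f tt
Unit-finite .Σ↔Fin B↔   = ↔-trans (mk↔ₛ′ (λ (_ , b) → b) (tt ,_) (λ _ → refl) (λ _ → refl)) (B↔ tt)

⊎-finite : ∀ {A B} → Finite A → Finite B → Finite (A ⊎ B)
⊎-finite FA FB .∑ f      = ∑ FA (f ∘ inj₁) + ∑ FB (f ∘ inj₂)
⊎-finite FA FB .Σ↔Fin B↔ =
  ↔-trans Σ-distribʳ-⊎ (↔-trans (Σ↔Fin FA (B↔ ∘ inj₁) ⊎-↔ Σ↔Fin FB (B↔ ∘ inj₂)) (↔-sym +↔⊎))

Σ-finite : ∀ {A} {B : A → Set} → Finite A → (∀ a → Finite (B a)) → Finite (Σ A B)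
Σ-finite FA FB .∑ f      = ∑ FA (λ a → ∑ (FB a) (λ b → f (a , b)))
Σ-finite FA FB .Σ↔Fin C↔ = ↔-trans Σ-assoc (Σ↔Fin FA (λ a → Σ↔Fin (FB a) (λ b → C↔ (a , b))))

↔-finite : ∀ {A B} → A ↔ B → Finite A → Finite B
↔-finite A↔B FA .∑ f      = ∑ FA (f ∘ Inverse.to A↔B)
↔-finite A↔B FA .Σ↔Fin C↔ = ↔-trans (↔-sym (Σ-cong A↔B ↔-refl)) (Σ↔Fin FA (C↔ ∘ Inverse.to A↔B))

Fin-finite : ∀ n → Finite (Fin n)
Fin-finite zero    = ↔-finite (↔-sym 0↔⊥) Empty-finite
Fin-finite (suc n) = ↔-finite (↔-trans (↔-sym 1↔⊤ ⊎-↔ ↔-refl) (↔-sym +↔⊎)) (⊎-finite Unit-finite (Fin-finite n))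

Subset-finite : ∀ n → Finite (Subset n)
Subset-finite zero    = ↔-finite (mk↔ₛ′ (λ _ → []) (λ _ → tt) (λ { [] → refl }) (λ _ → refl)) Unit-finite
Subset-finite (suc n) = ↔-finite cons↔ (⊎-finite (Subset-finite n) (Subset-finite n))
  where
  cons : Subset n ⊎ Subset n → Subset (suc n)
  cons (inj₁ p) = false ∷ p
  cons (inj₂ p) = true ∷ p

  uncons : Subset (suc n) → Subset n ⊎ Subset n
  uncons (false ∷ p) = inj₁ p
  uncons (true  ∷ p) = inj₂ p

  cons↔ : (Subset n ⊎ Subset n) ↔ Subset (suc n)
  cons↔ = mk↔ₛ′ cons uncons (λ { (false ∷ p) → refl ; (true ∷ p) → refl }) (λ { (inj₁ p) → refl ; (inj₂ p) → refl })

T-finite : ∀ b → Finite (T b)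
T-finite true  = Unit-finite
T-finite false = Empty-finite

∑-× : ∀ {A B} (FA : Finite A) (FB : Finite B) (f : A → ℕ) (g : B → ℕ) →
        ∑ (Σ-finite FA (λ _ → FB)) (λ (a , b) → f a * g b) ≡ ∑ FA f * ∑ FB g
∑-× FA FB f g = trans (∑-cong FA (λ a → ∑-distribˡ-* FB (f a) g)) (∑-distribʳ-* FA f (∑ FB g))

⟦_⟧ : Bool → ℕ
⟦ true  ⟧ = 1
⟦ false ⟧ = 0

T↔Fin⟦⟧ : ∀ b → T b ↔ Fin ⟦ b ⟧
T↔Fin⟦⟧ true  = ↔-sym 1↔⊤
T↔Fin⟦⟧ false = ↔-sym 0↔⊥

∑-T : ∀ b n → ∑ (T-finite b) (λ _ → n) ≡ ⟦ b ⟧ * n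
∑-T true  n = sym (+-identityʳ n)
∑-T false n = refl

∑-∈ : ∀ {n} (p : Subset n) → ∑ (Fin-finite n) (λ i → ⟦ does (i ∈? p) ⟧) ≡ ∣ p ∣
∑-∈ []          = refl
∑-∈ (true  ∷ p) = cong suc (∑-∈ p)
∑-∈ (false ∷ p) = ∑-∈ p

x∈p─q⇒x∉q : ∀ {n} {x : Fin n} {p q : Subset n} → x ∈ p ─ q → x ∉ q
x∈p─q⇒x∉q {p = true ∷ p} {false ∷ q} here ()
x∈p─q⇒x∉q {p = _ ∷ p} {_ ∷ q} (there x∈p─q) (there x∈q) = x∈p─q⇒x∉q x∈p─q x∈q

p⊆q⇒p-x⊆q-x : ∀ {n} {p q : Subset n} {x} → p ⊆ q → p - x ⊆ q - x
p⊆q⇒p-x⊆q-x {p = p} p⊆q y∈p-x = x∈p∧x∉q⇒x∈p─q (p⊆q (p─q⊆p p _ y∈p-x)) (x∈p─q⇒x∉q y∈p-x)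

x∈p⇒suc∣p-x∣≡∣p∣ : ∀ {n} {x : Fin n} {p : Subset n} → x ∈ p → suc ∣ p - x ∣ ≡ ∣ p ∣
x∈p⇒suc∣p-x∣≡∣p∣ {p = true  ∷ p} here        = cong (suc ∘ ∣_∣) (p─⊥≡p p)
x∈p⇒suc∣p-x∣≡∣p∣ {p = true  ∷ p} (there x∈p) = cong suc (x∈p⇒suc∣p-x∣≡∣p∣ x∈p)
x∈p⇒suc∣p-x∣≡∣p∣ {p = false ∷ p} (there x∈p) = x∈p⇒suc∣p-x∣≡∣p∣ x∈p

∣p∣≡0⇒p≡⊥ : ∀ {n} (p : Subset n) → ∣ p ∣ ≡ 0 → p ≡ ⊥
∣p∣≡0⇒p≡⊥ []          _     = refl
∣p∣≡0⇒p≡⊥ (false ∷ p) ∣p∣≡0 = cong (false ∷_) (∣p∣≡0⇒p≡⊥ p ∣p∣≡0)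

∣p∣≡1+t⇒Nonempty : ∀ {n t} (p : Subset n) → ∣ p ∣ ≡ suc t → Nonempty p
∣p∣≡1+t⇒Nonempty (true  ∷ p) _       = zero , here
∣p∣≡1+t⇒Nonempty (false ∷ p) ∣p∣≡1+t =
  let x , x∈p = ∣p∣≡1+t⇒Nonempty p ∣p∣≡1+t in suc x , there x∈p

infix 4 _⊆ᵇ_⊆ᵇ_

_⊆ᵇ_⊆ᵇ_ : ∀ {n} → Subset n → Subset n → Subset n → Bool
[]      ⊆ᵇ []      ⊆ᵇ []      = true
(r ∷ p) ⊆ᵇ (o ∷ q) ⊆ᵇ (a ∷ s) = ((not r ∨ o) ∧ (not o ∨ a)) ∧ (p ⊆ᵇ q ⊆ᵇ s)

⊥⊆ᵇ⊥⊆ᵇp : ∀ {n} (p : Subset n) → (⊥ ⊆ᵇ ⊥ ⊆ᵇ p) ≡ true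
⊥⊆ᵇ⊥⊆ᵇp []      = refl
⊥⊆ᵇ⊥⊆ᵇp (_ ∷ p) = ⊥⊆ᵇ⊥⊆ᵇp p

⊥⊆ᵇp⊆ᵇ⊤ : ∀ {n} (p : Subset n) → (⊥ ⊆ᵇ p ⊆ᵇ ⊤) ≡ true
⊥⊆ᵇp⊆ᵇ⊤ []          = refl
⊥⊆ᵇp⊆ᵇ⊤ (true  ∷ p) = ⊥⊆ᵇp⊆ᵇ⊤ p
⊥⊆ᵇp⊆ᵇ⊤ (false ∷ p) = ⊥⊆ᵇp⊆ᵇ⊤ p

p≡⊤⇔T[⊤⊆ᵇp⊆ᵇ⊤] : ∀ {n} (p : Subset n) → p ≡ ⊤ ⇔ T (⊤ ⊆ᵇ p ⊆ᵇ ⊤)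
p≡⊤⇔T[⊤⊆ᵇp⊆ᵇ⊤] p = mk⇔ ⊤-sandwiched (sandwiched-⊤ p)
  where
  ⊤-sandwiched : ∀ {n} {p : Subset n} → p ≡ ⊤ → T (⊤ ⊆ᵇ p ⊆ᵇ ⊤)
  ⊤-sandwiched {zero}  refl = tt
  ⊤-sandwiched {suc n} refl = ⊤-sandwiched {n} refl

  sandwiched-⊤ : ∀ {n} (p : Subset n) → T (⊤ ⊆ᵇ p ⊆ᵇ ⊤) → p ≡ ⊤
  sandwiched-⊤ []         _ = refl
  sandwiched-⊤ (true ∷ p) t = cong (true ∷_) (sandwiched-⊤ p t)

⟦⊥⊆ᵇ∪⊆ᵇ⟧ : ∀ {n} (p q s : Subset n) → ⟦ ⊥ ⊆ᵇ p ∪ q ⊆ᵇ s ⟧ ≡ ⟦ ⊥ ⊆ᵇ p ⊆ᵇ s ⟧ * ⟦ ⊥ ⊆ᵇ q ⊆ᵇ s ⟧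
⟦⊥⊆ᵇ∪⊆ᵇ⟧ []          []          []          = refl
⟦⊥⊆ᵇ∪⊆ᵇ⟧ (false ∷ p) (false ∷ q) (_ ∷ s)     = ⟦⊥⊆ᵇ∪⊆ᵇ⟧ p q s
⟦⊥⊆ᵇ∪⊆ᵇ⟧ (false ∷ p) (true  ∷ q) (true  ∷ s) = ⟦⊥⊆ᵇ∪⊆ᵇ⟧ p q s
⟦⊥⊆ᵇ∪⊆ᵇ⟧ (false ∷ p) (true  ∷ q) (false ∷ s) = sym (*-zeroʳ ⟦ ⊥ ⊆ᵇ p ⊆ᵇ s ⟧)
⟦⊥⊆ᵇ∪⊆ᵇ⟧ (true  ∷ p) (false ∷ q) (true  ∷ s) = ⟦⊥⊆ᵇ∪⊆ᵇ⟧ p q s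
⟦⊥⊆ᵇ∪⊆ᵇ⟧ (true  ∷ p) (true  ∷ q) (true  ∷ s) = ⟦⊥⊆ᵇ∪⊆ᵇ⟧ p q s
⟦⊥⊆ᵇ∪⊆ᵇ⟧ (true  ∷ p) (_     ∷ q) (false ∷ s) = refl

-- Removing x from the lower bound p splits the count according to whether x ∈ q.
⟦⊆ᵇ⊆ᵇ⟧-split : ∀ {n} {x : Fin n} {p q s : Subset n} → x ∈ p →
               ⟦ p - x ⊆ᵇ q ⊆ᵇ s ⟧ ≡ ⟦ p ⊆ᵇ q ⊆ᵇ s ⟧ + ⟦ p - x ⊆ᵇ q ⊆ᵇ s - x ⟧
⟦⊆ᵇ⊆ᵇ⟧-split {p = true ∷ p} {true  ∷ q} {a ∷ s} here =
  trans (cong (λ p′ → ⟦ a ∧ (p′ ⊆ᵇ q ⊆ᵇ s) ⟧) (p─⊥≡p p)) (sym (+-identityʳ _))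
⟦⊆ᵇ⊆ᵇ⟧-split {p = true ∷ p} {false ∷ q} {_ ∷ s} here =
  cong (λ s′ → ⟦ p ─ ⊥ ⊆ᵇ q ⊆ᵇ s′ ⟧) (sym (p─⊥≡p s))
⟦⊆ᵇ⊆ᵇ⟧-split {p = r ∷ p} {o ∷ q} {a ∷ s} (there x∈p) = ∧-split ((not r ∨ o) ∧ (not o ∨ a)) (⟦⊆ᵇ⊆ᵇ⟧-split x∈p)
  where
  ∧-split : ∀ b {x y z} → ⟦ x ⟧ ≡ ⟦ y ⟧ + ⟦ z ⟧ → ⟦ b ∧ x ⟧ ≡ ⟦ b ∧ y ⟧ + ⟦ b ∧ z ⟧
  ∧-split true  x≡y+z = x≡y+z
  ∧-split false _     = refl

∑-subsets-of-size : ∀ {n} (s : Subset n) a →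
  ∑ (Subset-finite n) (λ p → ⟦ a ≡ᵇ ∣ p ∣ ⟧ * ⟦ ⊥ ⊆ᵇ p ⊆ᵇ s ⟧) ≡ ∣ s ∣ C a
∑-subsets-of-size []                zero    = refl
∑-subsets-of-size []                (suc a) = refl
∑-subsets-of-size {suc n} (false ∷ s) a       =
  trans (cong₂ _+_ (∑-subsets-of-size s a)
                   (trans (∑-cong (Subset-finite n) (λ p → *-zeroʳ ⟦ a ≡ᵇ suc ∣ p ∣ ⟧)) (∑-zero (Subset-finite n))))
        (+-identityʳ _)
∑-subsets-of-size {suc n} (true ∷ s)  zero    =
  trans (cong₂ _+_ (∑-subsets-of-size s zero) (∑-zero (Subset-finite n))) (+-identityʳ 1)
∑-subsets-of-size {suc n} (true ∷ s)  (suc a) = begin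
  _                          ≡⟨ cong₂ _+_ (∑-subsets-of-size s (suc a)) (∑-subsets-of-size s a) ⟩
  ∣ s ∣ C suc a + ∣ s ∣ C a  ≡⟨ +-comm (∣ s ∣ C suc a) _ ⟩
  ∣ s ∣ C a + ∣ s ∣ C suc a  ≡⟨ nCk+nC[k+1]≡[n+1]C[k+1] ∣ s ∣ a ⟩
  suc ∣ s ∣ C suc a          ∎

module _ (n : ℕ) where

  private
    G : ℕ → ℕ → ℕ
    G r s = ∑ (Subset-finite r) (λ A → n C (∣ A ∣ + s))

    W : ℕ → ℕ → ℕ
    W r s = ∑ (Subset-finite r) (λ A → ∣ A ∣ * (n C (∣ A ∣ + s)))

    G-suc : ∀ r s → G (suc r) s ≡ G r s + G r (suc s)
    G-suc r s = cong (_+_ (G r s)) (∑-cong (Subset-finite r) (λ A → cong (n C_) (sym (+-suc ∣ A ∣ s))))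

    W-suc : ∀ r s → W (suc r) s ≡ W r s + (W r (suc s) + G r (suc s))
    W-suc r s = cong (_+_ (W r s)) (trans (∑-cong (Subset-finite r) add-element) (∑-distrib-+ (Subset-finite r) _ _))
      where
      add-element : ∀ A → suc ∣ A ∣ * (n C suc (∣ A ∣ + s)) ≡ ∣ A ∣ * (n C (∣ A ∣ + suc s)) + n C (∣ A ∣ + suc s)
      add-element A rewrite +-suc ∣ A ∣ s = +-comm (n C suc (∣ A ∣ + s)) _

  ∑-C-size : ∀ r s → ∑ (Subset-finite r) (λ A → n C (∣ A ∣ + s)) ≡ (n + r) C (r + s)
  ∑-C-size zero    s = cong (_C s) (sym (+-identityʳ n))
  ∑-C-size (suc r) s = begin
    G (suc r) s                                   ≡⟨ G-suc r s ⟩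
    G r s + G r (suc s)                           ≡⟨ cong₂ _+_ (∑-C-size r s) (∑-C-size r (suc s)) ⟩
    (n + r) C (r + s) + (n + r) C (r + suc s)     ≡⟨ cong (λ x → (n + r) C (r + s) + (n + r) C x) (+-suc r s) ⟩
    (n + r) C (r + s) + (n + r) C suc (r + s)     ≡⟨ nCk+nC[k+1]≡[n+1]C[k+1] (n + r) (r + s) ⟩
    suc (n + r) C suc (r + s)                     ≡⟨ cong (_C suc (r + s)) (sym (+-suc n r)) ⟩
    (n + suc r) C (suc r + s)                     ∎

  private
    W≡G : ∀ r s → W (suc r) s ≡ suc r * G r (suc s)
    W≡G zero    s = refl
    W≡G (suc r) s = begin
      W (suc (suc r)) s
        ≡⟨ W-suc (suc r) s ⟩
      W (suc r) s + (W (suc r) (suc s) + G (suc r) (suc s))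
        ≡⟨ cong₂ (λ x y → x + (y + G (suc r) (suc s))) (W≡G r s) (W≡G r (suc s)) ⟩
      suc r * x + (suc r * y + G (suc r) (suc s))
        ≡⟨ cong (λ z → suc r * x + (suc r * y + z)) (G-suc r (suc s)) ⟩
      suc r * x + (suc r * y + (x + y))
        ≡⟨ collect r x y ⟩
      suc (suc r) * (x + y)
        ≡⟨ cong (suc (suc r) *_) (sym (G-suc r (suc s))) ⟩
      suc (suc r) * G (suc r) (suc s) ∎
      where
      x = G r (suc s)
      y = G r (suc (suc s))
      collect : ∀ r x y → suc r * x + (suc r * y + (x + y)) ≡ suc (suc r) * (x + y)
      collect = solve-∀

  ∑-size*C-size : ∀ r → ∑ (Subset-finite r) (λ A → ∣ A ∣ * (n C ∣ A ∣)) ≡ formula n r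
  ∑-size*C-size zero    = refl
  ∑-size*C-size (suc r) = begin
    _                                  ≡⟨ ∑-cong (Subset-finite (suc r)) (λ A → cong (λ x → ∣ A ∣ * (n C x)) (sym (+-identityʳ ∣ A ∣))) ⟩
    W (suc r) 0                        ≡⟨ W≡G r 0 ⟩
    suc r * G r 1                      ≡⟨ cong (suc r *_) (∑-C-size r 1) ⟩
    suc r * ((n + r) C (r + 1))        ≡⟨ cong₂ (λ x y → suc r * (x C y)) (sym (cong (_∸ 1) (+-suc n r))) (+-comm r 1) ⟩
    suc r * ((n + suc r ∸ 1) C suc r)  ∎

module InclusionExclusion {X : Set} (F : Finite X) {k : ℕ} (occ : X → Subset k) where

  count-between : Subset k → Subset k → ℕ
  count-between p s = ∑ F (λ x → ⟦ p ⊆ᵇ occ x ⊆ᵇ s ⟧)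

  count-between-split : ∀ {x p s} → x ∈ p → count-between (p - x) s ≡ count-between p s + count-between (p - x) (s - x)
  count-between-split x∈p = trans (∑-cong F (λ y → ⟦⊆ᵇ⊆ᵇ⟧-split {q = occ y} x∈p)) (∑-distrib-+ F _ _)

  count-between≡Δ : (g : ℕ → ℕ) → (∀ s → count-between ⊥ s ≡ g ∣ s ∣) →
                    ∀ t u {p s} → ∣ p ∣ ≡ t → ∣ s ∣ ≡ t + u → p ⊆ s → + count-between p s ≡ Δ[ t ] (+_ ∘ g) u
  count-between≡Δ g count-within zero u {p} {s} ∣p∣≡0 ∣s∣≡u _ rewrite ∣p∣≡0⇒p≡⊥ p ∣p∣≡0 =
    cong +_ (trans (count-within s) (cong g ∣s∣≡u))
  count-between≡Δ g count-within (suc t) u {p} {s} ∣p∣≡1+t ∣s∣≡1+t+u p⊆s =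
    split⇒Δ (Δ[ t ] (+_ ∘ g)) u (sym (count-between-split x∈p))
      (count-between≡Δ g count-within t (suc u) {p - x} {s} ∣p-x∣≡t (trans ∣s∣≡1+t+u (sym (+-suc t u)))
                                                                    (p⊆s ∘ p─q⊆p p ⁅ x ⁆))
      (count-between≡Δ g count-within t u {p - x} {s - x} ∣p-x∣≡t ∣s-x∣≡t+u (p⊆q⇒p-x⊆q-x p⊆s))
    where
    x = proj₁ (∣p∣≡1+t⇒Nonempty p ∣p∣≡1+t)
    x∈p = proj₂ (∣p∣≡1+t⇒Nonempty p ∣p∣≡1+t)
    ∣p-x∣≡t : ∣ p - x ∣ ≡ t
    ∣p-x∣≡t = suc-injective (trans (x∈p⇒suc∣p-x∣≡∣p∣ x∈p) ∣p∣≡1+t)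
    ∣s-x∣≡t+u : ∣ s - x ∣ ≡ t + u
    ∣s-x∣≡t+u = suc-injective (trans (x∈p⇒suc∣p-x∣≡∣p∣ (p⊆s x∈p)) ∣s∣≡1+t+u)

⇔⇒↔ : ∀ {A B : Set} → Irrelevant A → Irrelevant B → A ⇔ B → A ↔ B
⇔⇒↔ irrA irrB A⇔B = mk↔ₛ′ (Equivalence.to A⇔B) (Equivalence.from A⇔B) (λ _ → irrB _ _) (λ _ → irrA _ _)

does-↔ : ∀ {A : Set} (a? : Dec A) → Irrelevant A → T (does a?) ↔ A
does-↔ a? irr = ↔-trans (subst (λ b → T b ↔ True a?) (isYes≗does a?) ↔-refl) (True-↔ a? irr)

module _ {k r : ℕ} where

  -- The propositional fields of a placement replaced by Boolean tests, so that a placement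
  -- becomes an element of a finite Σ-type.
  PlacementData : Set
  PlacementData = Σ[ A ∈ Subset r ] Σ[ S ∈ Subset k ] Σ[ c ∈ Fin k ]
                    (T (does (1 ≤? ∣ A ∣)) × T (does (∣ A ∣ ≟ ∣ S ∣)) × T (does (c ∈? S)))

  PlacementData↔Placement : PlacementData ↔ Placement k r
  PlacementData↔Placement =
    ↔-trans (congˡ λ {A} → congˡ λ {S} → congˡ λ {c} →
               does-↔ (1 ≤? ∣ A ∣) ≤-irrelevant ×-↔ does-↔ (∣ A ∣ ≟ ∣ S ∣) ≡-irrelevant ×-↔ does-↔ (c ∈? S) []=-irrelevant)
            (mk↔ₛ′ (λ (A , S , c , ne , eq , el) → placement A S c ne eq el)
                   (λ (placement A S c ne eq el) → A , S , c , ne , eq , el) (λ _ → refl) (λ _ → refl))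

Placement-finite : ∀ k r → Finite (Placement k r)
Placement-finite k r = ↔-finite PlacementData↔Placement
  (Σ-finite (Subset-finite r) λ A → Σ-finite (Subset-finite k) λ S → Σ-finite (Fin-finite k) λ c →
   Σ-finite (T-finite _) λ _ → Σ-finite (T-finite _) λ _ → T-finite _)

private
  ⟦1≤ᵇ⟧*-absorb : ∀ a m → ⟦ 1 ≤ᵇ a ⟧ * (a * m) ≡ a * m
  ⟦1≤ᵇ⟧*-absorb zero    m = refl
  ⟦1≤ᵇ⟧*-absorb (suc a) m = +-identityʳ _

  ⟦≡ᵇ⟧*-subst : ∀ a b (f : ℕ → ℕ) → ⟦ a ≡ᵇ b ⟧ * f b ≡ ⟦ a ≡ᵇ b ⟧ * f a
  ⟦≡ᵇ⟧*-subst zero    zero    f = refl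
  ⟦≡ᵇ⟧*-subst zero    (suc b) f = refl
  ⟦≡ᵇ⟧*-subst (suc a) zero    f = refl
  ⟦≡ᵇ⟧*-subst (suc a) (suc b) f = ⟦≡ᵇ⟧*-subst a b (f ∘ suc)

∑-Placement-within : ∀ k r (s : Subset k) →
  ∑ (Placement-finite k r) (λ p → ⟦ ⊥ ⊆ᵇ Placement.C p ⊆ᵇ s ⟧) ≡ formula ∣ s ∣ r
∑-Placement-within k r s = begin
  _ ≡⟨ ∑-cong (Subset-finite r) (λ A → ∑-cong (Subset-finite k) (λ S → ∑-eldest-seat A S)) ⟩
  ∑ (Subset-finite r) (λ A → ∑ (Subset-finite k) λ S → ⟦ 1 ≤ᵇ ∣ A ∣ ⟧ * (⟦ ∣ A ∣ ≡ᵇ ∣ S ∣ ⟧ * (∣ S ∣ * w S)))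
    ≡⟨ ∑-cong (Subset-finite r) (λ A → ∑-chairs ∣ A ∣) ⟩
  ∑ (Subset-finite r) (λ A → ∣ A ∣ * (∣ s ∣ C ∣ A ∣))
    ≡⟨ ∑-size*C-size ∣ s ∣ r ⟩
  formula ∣ s ∣ r ∎
  where
  w : Subset k → ℕ
  w S = ⟦ ⊥ ⊆ᵇ S ⊆ᵇ s ⟧

  ∑-T³ : ∀ x y z m → ∑ (T-finite x) (λ _ → ∑ (T-finite y) λ _ → ∑ (T-finite z) λ _ → m) ≡ ⟦ x ⟧ * (⟦ y ⟧ * (⟦ z ⟧ * m))
  ∑-T³ x y z m = trans (∑-T x _) (cong (⟦ x ⟧ *_) (trans (∑-T y _) (cong (⟦ y ⟧ *_) (∑-T z m))))

  ∑-eldest-seat : ∀ (A : Subset r) S →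
    ∑ (Fin-finite k) (λ c → ∑ (T-finite (1 ≤ᵇ ∣ A ∣)) λ _ → ∑ (T-finite (∣ A ∣ ≡ᵇ ∣ S ∣)) λ _ →
                            ∑ (T-finite (does (c ∈? S))) λ _ → w S)
    ≡ ⟦ 1 ≤ᵇ ∣ A ∣ ⟧ * (⟦ ∣ A ∣ ≡ᵇ ∣ S ∣ ⟧ * (∣ S ∣ * w S))
  ∑-eldest-seat A S = begin
    _ ≡⟨ ∑-cong F (λ c → ∑-T³ x y (does (c ∈? S)) (w S)) ⟩
    ∑ F (λ c → ⟦ x ⟧ * (⟦ y ⟧ * (⟦ does (c ∈? S) ⟧ * w S)))   ≡⟨ ∑-distribˡ-* F ⟦ x ⟧ _ ⟩
    ⟦ x ⟧ * ∑ F (λ c → ⟦ y ⟧ * (⟦ does (c ∈? S) ⟧ * w S))     ≡⟨ cong (⟦ x ⟧ *_) (∑-distribˡ-* F ⟦ y ⟧ _) ⟩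
    ⟦ x ⟧ * (⟦ y ⟧ * ∑ F (λ c → ⟦ does (c ∈? S) ⟧ * w S))     ≡⟨ cong (λ m → ⟦ x ⟧ * (⟦ y ⟧ * m)) (∑-distribʳ-* F _ (w S)) ⟩
    ⟦ x ⟧ * (⟦ y ⟧ * (∑ F (λ c → ⟦ does (c ∈? S) ⟧) * w S))   ≡⟨ cong (λ m → ⟦ x ⟧ * (⟦ y ⟧ * (m * w S))) (∑-∈ S) ⟩
    ⟦ x ⟧ * (⟦ y ⟧ * (∣ S ∣ * w S))                           ∎
    where
    F = Fin-finite k
    x = 1 ≤ᵇ ∣ A ∣
    y = ∣ A ∣ ≡ᵇ ∣ S ∣

  ∑-chairs : ∀ a → ∑ (Subset-finite k) (λ S → ⟦ 1 ≤ᵇ a ⟧ * (⟦ a ≡ᵇ ∣ S ∣ ⟧ * (∣ S ∣ * w S))) ≡ a * (∣ s ∣ C a)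
  ∑-chairs a = begin
    _ ≡⟨ ∑-distribˡ-* F ⟦ 1 ≤ᵇ a ⟧ _ ⟩
    ⟦ 1 ≤ᵇ a ⟧ * ∑ F (λ S → ⟦ a ≡ᵇ ∣ S ∣ ⟧ * (∣ S ∣ * w S))
      ≡⟨ cong (⟦ 1 ≤ᵇ a ⟧ *_) (∑-cong F λ S →
           trans (⟦≡ᵇ⟧*-subst a ∣ S ∣ (_* w S)) (x∙yz≈y∙xz *-commutativeSemigroup ⟦ a ≡ᵇ ∣ S ∣ ⟧ a (w S))) ⟩
    ⟦ 1 ≤ᵇ a ⟧ * ∑ F (λ S → a * (⟦ a ≡ᵇ ∣ S ∣ ⟧ * w S))
      ≡⟨ cong (⟦ 1 ≤ᵇ a ⟧ *_) (∑-distribˡ-* F a _) ⟩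
    ⟦ 1 ≤ᵇ a ⟧ * (a * ∑ F (λ S → ⟦ a ≡ᵇ ∣ S ∣ ⟧ * w S))
      ≡⟨ cong (λ m → ⟦ 1 ≤ᵇ a ⟧ * (a * m)) (∑-subsets-of-size s a) ⟩
    ⟦ 1 ≤ᵇ a ⟧ * (a * (∣ s ∣ C a))
      ≡⟨ ⟦1≤ᵇ⟧*-absorb a _ ⟩
    a * (∣ s ∣ C a) ∎
    where F = Subset-finite k

Placement↔Fin : ∀ k r → Placement k r ↔ Fin (formula k r)
Placement↔Fin k r = ↔-trans (↔Fin-∑1 (Placement-finite k r)) (Fin-cong (begin
  ∑ (Placement-finite k r) (λ _ → 1)
    ≡⟨ ∑-cong (Placement-finite k r) (λ p → sym (cong ⟦_⟧ (⊥⊆ᵇp⊆ᵇ⊤ (Placement.C p)))) ⟩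
  ∑ (Placement-finite k r) (λ p → ⟦ ⊥ ⊆ᵇ Placement.C p ⊆ᵇ ⊤ ⟧)
    ≡⟨ ∑-Placement-within k r ⊤ ⟩
  formula ∣ ⊤ {k} ∣ r
    ≡⟨ cong (λ n → formula n r) (∣⊤∣≡n k) ⟩
  formula k r ∎))

Placements↔Fin : ∀ k {m} (rs : Vec ℕ m) → Placements k rs ↔ Fin (prodV (formula k) rs)
Placements↔Fin k []       = ↔-sym 1↔⊤
Placements↔Fin k (r ∷ rs) = ↔-trans (Placement↔Fin k r ×-↔ Placements↔Fin k rs) (↔-sym *↔×)

Placements-finite : ∀ k {m} (rs : Vec ℕ m) → Finite (Placements k rs)
Placements-finite k []       = Unit-finite
Placements-finite k (r ∷ rs) = Σ-finite (Placement-finite k r) (λ _ → Placements-finite k rs)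

∑-Placements-within : ∀ k {m} (rs : Vec ℕ m) (s : Subset k) →
  ∑ (Placements-finite k rs) (λ ps → ⟦ ⊥ ⊆ᵇ occupied rs ps ⊆ᵇ s ⟧) ≡ prodV (formula ∣ s ∣) rs
∑-Placements-within k []       s = cong ⟦_⟧ (⊥⊆ᵇ⊥⊆ᵇp s)
∑-Placements-within k (r ∷ rs) s = begin
  _ ≡⟨ ∑-cong (Placements-finite k (r ∷ rs)) (λ (p , ps) → ⟦⊥⊆ᵇ∪⊆ᵇ⟧ (Placement.C p) (occupied rs ps) s) ⟩
  _ ≡⟨ ∑-× (Placement-finite k r) (Placements-finite k rs) (λ p → ⟦ ⊥ ⊆ᵇ Placement.C p ⊆ᵇ s ⟧)
                                                           (λ ps → ⟦ ⊥ ⊆ᵇ occupied rs ps ⊆ᵇ s ⟧) ⟩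
  _ ≡⟨ cong₂ _*_ (∑-Placement-within k r s) (∑-Placements-within k rs s) ⟩
  prodV (formula ∣ s ∣) (r ∷ rs) ∎

module SurjectiveCount (k : ℕ) {m} (rs : Vec ℕ m) where

  open InclusionExclusion (Placements-finite k rs) (occupied rs) public

  SurjPlacements↔Fin : SurjPlacements k rs ↔ Fin (count-between ⊤ ⊤)
  SurjPlacements↔Fin =
    ↔-trans (congˡ (⇔⇒↔ (Decidable⇒UIP.≡-irrelevant (≡-dec Bool._≟_)) T-irrelevant (p≡⊤⇔T[⊤⊆ᵇp⊆ᵇ⊤] _)))
            (Σ↔Fin (Placements-finite k rs) (λ ps → T↔Fin⟦⟧ (⊤ ⊆ᵇ occupied rs ps ⊆ᵇ ⊤)))

  count-surjective≡Δ : + count-between ⊤ ⊤ ≡ Δ[ k ] (λ n → + prodV (formula n) rs) 0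
  count-surjective≡Δ =
    count-between≡Δ (λ n → prodV (formula n) rs) (∑-Placements-within k rs) k 0 {⊤} {⊤}
                    (∣⊤∣≡n k) (trans (∣⊤∣≡n k) (sym (+-identityʳ k))) ⊆-refl

formula-0 : ∀ r → formula 0 r ≡ 0
formula-0 zero    = refl
formula-0 (suc r) = trans (cong (suc r *_) (k>n⇒nCk≡0 (n<1+n r))) (*-zeroʳ (suc r))

proposition2 : (k m : ℕ) → 1 ≤ k → 1 ≤ m → (rs : Vec ℕ m) → (∀ (l : Fin m) → 1 ≤ lookup rs l)
    → ((l : Fin m) → Placement k (lookup rs l) ↔ Fin (formula k (lookup rs l)))
      × (Placements k rs ↔ Fin (prodV (formula k) rs))
      × Σ ℕ (λ N → (SurjPlacements k rs ↔ Fin N) × (+ N ≡ surjFormula k rs))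
proposition2 k (suc m) _ _ (r ∷ rs) _ =
    (λ l → Placement↔Fin k (lookup (r ∷ rs) l))
  , Placements↔Fin k (r ∷ rs)
  , count-between ⊤ ⊤
  , SurjPlacements↔Fin
  , trans count-surjective≡Δ (Δ[]-at-0 k _ (cong (λ x → + (x * prodV (formula 0) rs)) (formula-0 r)))
  where open SurjectiveCount k (r ∷ rs)
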